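{- Let $S$ be a non special numerical semigroup and $T=\mathcal{A}(S)$. Then $T$ is neither irreducible nor ordinary.
   Context: $\mathbb{N}=\{0,1,2,\ldots\}$. A numerical semigroup is a submonoid $S$ of $(\mathbb{N},+)$ with $\mathbb{N}\setminus S$ finite. $\operatorname{H}(S)=\mathbb{N}\setminus S$; $\operatorname{F}(S)=\max\operatorname{H}(S)$; $\operatorname{m}(S)=\min(S\setminus\{0\})$. Special gaps: $\operatorname{SG}(S)=\{h\in\operatorname{H}(S)\mid 2h\in S \text{ and } h+s\in S \text{ for all } s\in S\setminus\{0\}\}$. $S$ is special if there is no $h\in\operatorname{SG}(S)\setminus\{\operatorname{F}(S)\}$ with $h>\operatorname{m}(S)$. $S$ is irreducible if it cannot be written as the intersection of two numerical semigroups properly containing $S$; $S$ is ordinary if $S=\{0\}\cup\{x\in\mathbb{N}\mid x\ge c\}$ for some $c$. For a non special $S$, with $h=\max(\operatorname{SG}(S)\setminus\{\operatorname{F}(S)\})$, $\mathcal{A}(S)=(S\cup\{h\})\setminus\{\operatorname{m}(S)\}$. -}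

module Defs where

open import Data.Nat using (ℕ; zero; suc; _+_; _*_; _≤_; _<_; _≡ᵇ_)
open import Data.Bool using (Bool; true; false; _∧_; _∨_; not)
open import Data.Sum using (_⊎_)
open import Data.Product using (Σ; ∃; _×_; _,_)
open import Relation.Nullary using (¬_)
open import Relation.Binary.PropositionalEquality using (_≡_; _≢_)

Subset : Set
Subset = ℕ → Bool

_∈_ : ℕ → Subset → Set
x ∈ S = S x ≡ true

_∉_ : ℕ → Subset → Set
x ∉ S = S x ≡ false

record IsNumericalSemigroup (S : Subset) : Set where
  field
    zero∈   : 0 ∈ S
    +-closed : ∀ a b → a ∈ S → b ∈ S → (a + b) ∈ S
    cofinite : ∃ λ c → ∀ n → c ≤ n → n ∈ S

IsFrobenius : Subset → ℕ → Set
IsFrobenius S f = f ∉ S × (∀ h → h ∉ S → h ≤ f)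

IsMultiplicity : Subset → ℕ → Set
IsMultiplicity S m = m ≢ 0 × m ∈ S × (∀ x → x ∈ S → x ≢ 0 → m ≤ x)

IsSpecialGap : Subset → ℕ → Set
IsSpecialGap S h = h ∉ S × (2 * h) ∈ S × (∀ s → s ∈ S → s ≢ 0 → (h + s) ∈ S)

IsSpecial : Subset → ℕ → ℕ → Set
IsSpecial S f m = ¬ (∃ λ h → IsSpecialGap S h × h ≢ f × m < h)

IsMaxSGnotF : Subset → ℕ → ℕ → Set
IsMaxSGnotF S f h =
  IsSpecialGap S h × h ≢ f × (∀ g → IsSpecialGap S g → g ≢ f → g ≤ h)

𝒜 : Subset → ℕ → ℕ → Subset
𝒜 S h m x = (S x ∨ (x ≡ᵇ h)) ∧ not (x ≡ᵇ m)

_⊊_ : Subset → Subset → Set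
T ⊊ S' = (∀ x → x ∈ T → x ∈ S') × (∃ λ x → x ∈ S' × x ∉ T)

IsIrreducible : Subset → Set
IsIrreducible T =
  ¬ (∃ λ S₁ → ∃ λ S₂ → IsNumericalSemigroup S₁ × IsNumericalSemigroup S₂ ×
      T ⊊ S₁ × T ⊊ S₂ × (∀ x → T x ≡ (S₁ x ∧ S₂ x)))

IsOrdinary : Subset → Set
IsOrdinary T = ∃ λ c → ∀ x → (x ∈ T → (x ≡ 0 ⊎ c ≤ x)) × ((x ≡ 0 ⊎ c ≤ x) → x ∈ T)

{-# OPTIONS --safe #-}
module Submission where

-- Since m < h, the multiplicity of S ∪ {h} is still m, and removing it leaves the numerical
-- semigroup T = 𝒜(S).  The gaps of T lie below F(S), so F(S) = F(T) is a special gap of T and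
-- T = (S ∪ {h}) ∩ (T ∪ {F}) exhibits T as reducible.  T is not ordinary because its nonzero
-- element h lies below its gap F.

open import Defs
open import Data.Nat using (ℕ; suc; _+_; _*_; _≤_; _<_; _≡ᵇ_; z≤n)
open import Data.Nat.Properties
open import Data.Bool using (true; false; _∧_; _∨_; not)
open import Data.Bool.Properties using (T-≡; ¬-not; not-¬; ∨-zeroʳ; ∧-zeroʳ)
open import Data.Sum using (_⊎_; inj₁; inj₂)
open import Data.Product using (_×_; _,_; proj₁; proj₂)
open import Data.Empty using (⊥-elim)
open import Function using (_∘_; Equivalence)
open import Relation.Nullary using (¬_; yes; no; contradiction)
open import Relation.Binary.PropositionalEquality

private
  variable
    S T : Subset
    a f g h m x : ℕ

-- With these, 𝒜 S h m is definitionally S ∪⁅ h ⁆ ∖⁅ m ⁆.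
infixl 30 _∪⁅_⁆ _∖⁅_⁆

_∪⁅_⁆ : Subset → ℕ → Subset
(S ∪⁅ a ⁆) x = S x ∨ (x ≡ᵇ a)

_∖⁅_⁆ : Subset → ℕ → Subset
(S ∖⁅ a ⁆) x = S x ∧ not (x ≡ᵇ a)

≢true⇒≡false : ∀ {b} → b ≢ true → b ≡ false
≢true⇒≡false = ¬-not

≡false⇒≢true : ∀ {b} → b ≡ false → b ≢ true
≡false⇒≢true = not-¬

≡ᵇ-true⇒≡ : ∀ x y → (x ≡ᵇ y) ≡ true → x ≡ y
≡ᵇ-true⇒≡ x y = ≡ᵇ⇒≡ x y ∘ Equivalence.from T-≡

≡ᵇ-refl : ∀ x → (x ≡ᵇ x) ≡ true
≡ᵇ-refl x = Equivalence.to T-≡ (≡⇒≡ᵇ x x refl)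

≢⇒≡ᵇ-false : ∀ {x y} → x ≢ y → (x ≡ᵇ y) ≡ false
≢⇒≡ᵇ-false x≢y = ≢true⇒≡false (x≢y ∘ ≡ᵇ-true⇒≡ _ _)

module _ (S : Subset) (a : ℕ) where

  ∈-∪⁅⁆⁺ˡ : x ∈ S → x ∈ S ∪⁅ a ⁆
  ∈-∪⁅⁆⁺ˡ x∈S rewrite x∈S = refl

  ∈-∪⁅⁆⁺ʳ : a ∈ S ∪⁅ a ⁆
  ∈-∪⁅⁆⁺ʳ rewrite ≡ᵇ-refl a = ∨-zeroʳ (S a)

  ∈-∪⁅⁆⁻ : x ∈ S ∪⁅ a ⁆ → x ∈ S ⊎ x ≡ a
  ∈-∪⁅⁆⁻ {x} x∈ with S x
  ... | true  = inj₁ refl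
  ... | false = inj₂ (≡ᵇ-true⇒≡ x a x∈)

  ∉-∪⁅⁆⁻ : x ∉ S ∪⁅ a ⁆ → x ∉ S
  ∉-∪⁅⁆⁻ x∉ = ≢true⇒≡false (≡false⇒≢true x∉ ∘ ∈-∪⁅⁆⁺ˡ)

  ∈-∖⁅⁆⁺ : x ∈ S → x ≢ a → x ∈ S ∖⁅ a ⁆
  ∈-∖⁅⁆⁺ x∈S x≢a rewrite x∈S | ≢⇒≡ᵇ-false x≢a = refl

  ∉-∖⁅⁆ : a ∉ S ∖⁅ a ⁆
  ∉-∖⁅⁆ rewrite ≡ᵇ-refl a = ∧-zeroʳ (S a)

  ∈-∖⁅⁆⁻ : x ∈ S ∖⁅ a ⁆ → x ∈ S × x ≢ a
  ∈-∖⁅⁆⁻ {x} x∈ = x∈S , λ { refl → ≡false⇒≢true ∉-∖⁅⁆ x∈ }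
    where
    x∈S : x ∈ S
    x∈S with S x
    ... | true  = refl
    ... | false = x∈

  ∖⁅⁆-⊊ : a ∈ S → S ∖⁅ a ⁆ ⊊ S
  ∖⁅⁆-⊊ a∈S = (λ _ → proj₁ ∘ ∈-∖⁅⁆⁻) , a , a∈S , ∉-∖⁅⁆

⊆⇒≡∩∪⁅⁆ : (∀ x → x ∈ T → x ∈ S) → a ∉ S → ∀ x → T x ≡ S x ∧ (T ∪⁅ a ⁆) x
⊆⇒≡∩∪⁅⁆ {T = T} {S = S} {a = a} T⊆S a∉S x with T x in x∈T | x ≟ a
... | true  | _        rewrite T⊆S x x∈T = refl
... | false | yes refl rewrite a∉S = refl
... | false | no x≢a   rewrite ≢⇒≡ᵇ-false x≢a = sym (∧-zeroʳ (S x))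

>frobenius⇒∈ : IsFrobenius S f → f < x → x ∈ S
>frobenius⇒∈ {S = S} {x = x} (_ , gaps≤f) f<x with S x in x∉S
... | true  = refl
... | false = contradiction (gaps≤f x x∉S) (<⇒≱ f<x)

∪-frobenius : IsFrobenius S f → a ≢ f → IsFrobenius (S ∪⁅ a ⁆) f
∪-frobenius {S = S} {f = f} {a = a} (f∉S , gaps≤f) a≢f = f∉ , λ x → gaps≤f x ∘ ∉-∪⁅⁆⁻ S a
  where
  f∉ : f ∉ S ∪⁅ a ⁆
  f∉ rewrite f∉S | ≢⇒≡ᵇ-false (a≢f ∘ sym) = refl

∖-frobenius : IsFrobenius S f → a ≤ f → IsFrobenius (S ∖⁅ a ⁆) f
∖-frobenius {S = S} {f = f} {a = a} (f∉S , gaps≤f) a≤f = f∉ , gaps≤f′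
  where
  f∉ : f ∉ S ∖⁅ a ⁆
  f∉ rewrite f∉S = refl
  gaps≤f′ : ∀ x → x ∉ S ∖⁅ a ⁆ → x ≤ f
  gaps≤f′ x x∉ with x ≟ a
  ... | yes refl = a≤f
  ... | no x≢a   = gaps≤f x (≢true⇒≡false λ x∈S → ≡false⇒≢true x∉ (∈-∖⁅⁆⁺ S a x∈S x≢a))

∪-multiplicity : IsMultiplicity S m → m ≤ a → IsMultiplicity (S ∪⁅ a ⁆) m
∪-multiplicity {S = S} {m = m} {a = a} (m≢0 , m∈S , m≤) m≤a = m≢0 , ∈-∪⁅⁆⁺ˡ S a m∈S , m≤′
  where
  m≤′ : ∀ x → x ∈ S ∪⁅ a ⁆ → x ≢ 0 → m ≤ x
  m≤′ x x∈ x≢0 with ∈-∪⁅⁆⁻ S a x∈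
  ... | inj₁ x∈S  = m≤ x x∈S x≢0
  ... | inj₂ refl = m≤a

module _ (ns : IsNumericalSemigroup S) where
  open IsNumericalSemigroup ns

  frobenius-specialGap : IsFrobenius S f → IsSpecialGap S f
  frobenius-specialGap {f = f} fr@(f∉S , _) =
    f∉S , 2f∈S , λ s _ s≢0 → >frobenius⇒∈ fr (m<m+n f (n≢0⇒n>0 s≢0))
    where
    f≢0 : f ≢ 0
    f≢0 refl = ≡false⇒≢true f∉S zero∈
    2f∈S : (2 * f) ∈ S
    2f∈S = >frobenius⇒∈ fr (subst (f <_) (cong (f +_) (sym (+-identityʳ f))) (m<m+n f (n≢0⇒n>0 f≢0)))

  ∪-specialGap : IsSpecialGap S h → IsNumericalSemigroup (S ∪⁅ h ⁆)
  ∪-specialGap {h = h} (_ , 2h∈S , h+s∈S) = record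
    { zero∈    = ∈-∪⁅⁆⁺ˡ S h zero∈
    ; +-closed = closed
    ; cofinite = proj₁ cofinite , λ n → ∈-∪⁅⁆⁺ˡ S h ∘ proj₂ cofinite n
    }
    where
    h+∈ : ∀ s → s ∈ S → (h + s) ∈ S ∪⁅ h ⁆
    h+∈ s s∈S with s ≟ 0
    ... | yes refl = subst (_∈ S ∪⁅ h ⁆) (sym (+-identityʳ h)) (∈-∪⁅⁆⁺ʳ S h)
    ... | no s≢0   = ∈-∪⁅⁆⁺ˡ S h (h+s∈S s s∈S s≢0)
    closed : ∀ a b → a ∈ S ∪⁅ h ⁆ → b ∈ S ∪⁅ h ⁆ → (a + b) ∈ S ∪⁅ h ⁆
    closed a b a∈ b∈ with ∈-∪⁅⁆⁻ S h a∈ | ∈-∪⁅⁆⁻ S h b∈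
    ... | inj₁ a∈S  | inj₁ b∈S  = ∈-∪⁅⁆⁺ˡ S h (+-closed a b a∈S b∈S)
    ... | inj₂ refl | inj₁ b∈S  = h+∈ b b∈S
    ... | inj₁ a∈S  | inj₂ refl = subst (_∈ S ∪⁅ h ⁆) (+-comm h a) (h+∈ a a∈S)
    ... | inj₂ refl | inj₂ refl =
      ∈-∪⁅⁆⁺ˡ S h (subst (_∈ S) (cong (h +_) (+-identityʳ h)) 2h∈S)

  ∖-multiplicity : IsMultiplicity S m → IsNumericalSemigroup (S ∖⁅ m ⁆)
  ∖-multiplicity {m = m} (m≢0 , _ , m≤) = record
    { zero∈    = ∈-∖⁅⁆⁺ S m zero∈ (m≢0 ∘ sym)
    ; +-closed = closed
    ; cofinite = c + suc m , large∈
    }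
    where
    c = proj₁ cofinite
    closed : ∀ a b → a ∈ S ∖⁅ m ⁆ → b ∈ S ∖⁅ m ⁆ → (a + b) ∈ S ∖⁅ m ⁆
    closed a b a∈ b∈ with ∈-∖⁅⁆⁻ S m a∈ | ∈-∖⁅⁆⁻ S m b∈ | a ≟ 0 | b ≟ 0
    ... | _       | _       | yes refl | _        = b∈
    ... | _       | _       | no _     | yes refl = subst (_∈ S ∖⁅ m ⁆) (sym (+-identityʳ a)) a∈
    ... | a∈S , _ | b∈S , _ | no a≢0   | no b≢0   =
      ∈-∖⁅⁆⁺ S m (+-closed a b a∈S b∈S) (>⇒≢ (≤-<-trans (m≤ a a∈S a≢0) (m<m+n a (n≢0⇒n>0 b≢0))))
    large∈ : ∀ n → c + suc m ≤ n → n ∈ S ∖⁅ m ⁆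
    large∈ n le = ∈-∖⁅⁆⁺ S m (proj₂ cofinite n (≤-trans (m≤m+n c (suc m)) le))
                             (>⇒≢ (<-≤-trans (m≤n+m (suc m) c) le))

∪⁅⁆-¬irreducible : IsNumericalSemigroup S → IsNumericalSemigroup (T ∪⁅ a ⁆) →
                   T ⊊ S → a ∉ S → ¬ IsIrreducible T
∪⁅⁆-¬irreducible {S = S} {T = T} {a = a} nsS nsT∪a T⊊S@(T⊆S , _) a∉S irreducible =
  irreducible (S , T ∪⁅ a ⁆ , nsS , nsT∪a , T⊊S , T⊊T∪a , ⊆⇒≡∩∪⁅⁆ T⊆S a∉S)
  where
  T⊊T∪a : T ⊊ T ∪⁅ a ⁆
  T⊊T∪a = (λ _ → ∈-∪⁅⁆⁺ˡ T a) , a , ∈-∪⁅⁆⁺ʳ T a , ≢true⇒≡false (≡false⇒≢true a∉S ∘ T⊆S a)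

∈-≤-∉⇒¬ordinary : x ∈ T → x ≢ 0 → g ∉ T → x ≤ g → ¬ IsOrdinary T
∈-≤-∉⇒¬ordinary {x = x} {g = g} x∈T x≢0 g∉T x≤g (c , ordinary) with proj₁ (ordinary x) x∈T
... | inj₁ x≡0 = x≢0 x≡0
... | inj₂ c≤x = ≡false⇒≢true g∉T (proj₂ (ordinary g) (inj₂ (≤-trans c≤x x≤g)))

¬special⇒multiplicity<maxSG : ¬ IsSpecial S f m → IsMaxSGnotF S f h → m < h
¬special⇒multiplicity<maxSG {m = m} {h = h} nonSpecial (_ , _ , maxSG) with m <? h
... | yes m<h = m<h
... | no m≮h  =
  ⊥-elim (nonSpecial λ { (g , sg , g≢f , m<g) → m≮h (<-≤-trans m<g (maxSG g sg g≢f)) })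

lemma4p4 : (S : Subset) → IsNumericalSemigroup S →
             (f m : ℕ) → IsFrobenius S f → IsMultiplicity S m →
             ¬ IsSpecial S f m →
             (h : ℕ) → IsMaxSGnotF S f h →
             ¬ IsIrreducible (𝒜 S h m) × ¬ IsOrdinary (𝒜 S h m)
lemma4p4 S ns f m fr mu@(_ , m∈S , _) nonSpecial h mx@(sg@(h∉S , _) , h≢f , _) =
  ∪⁅⁆-¬irreducible nsS∪h nsT∪f (∖⁅⁆-⊊ (S ∪⁅ h ⁆) m (∈-∪⁅⁆⁺ˡ S h m∈S)) (proj₁ frS∪h) ,
  ∈-≤-∉⇒¬ordinary h∈T (>⇒≢ (≤-<-trans z≤n m<h)) (proj₁ frT) h≤f
  where
  m<h = ¬special⇒multiplicity<maxSG nonSpecial mx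
  h≤f = proj₂ fr h h∉S
  nsS∪h = ∪-specialGap ns sg
  nsT = ∖-multiplicity nsS∪h (∪-multiplicity mu (<⇒≤ m<h))
  frS∪h = ∪-frobenius fr h≢f
  frT = ∖-frobenius frS∪h (≤-trans (<⇒≤ m<h) h≤f)
  nsT∪f = ∪-specialGap nsT (frobenius-specialGap nsT frT)
  h∈T = ∈-∖⁅⁆⁺ (S ∪⁅ h ⁆) m (∈-∪⁅⁆⁺ʳ S h) (>⇒≢ m<h)
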